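{- In every $C$-monoid $(S_\bot,M)$ where $M$ is an ada, $(f\circ T)[f,f]=f$ for all $f\in S_\bot$.
   Context: A $C$-algebra is an algebra $(M,\vee,\wedge,\neg)$ of type $(2,2,1)$ satisfying, for all $\alpha,\beta,\gamma$: $\neg\neg\alpha=\alpha$; $\neg(\alpha\wedge\beta)=\neg\alpha\vee\neg\beta$; $(\alpha\wedge\beta)\wedge\gamma=\alpha\wedge(\beta\wedge\gamma)$; $\alpha\wedge(\beta\vee\gamma)=(\alpha\wedge\beta)\vee(\alpha\wedge\gamma)$; $(\alpha\vee\beta)\wedge\gamma=(\alpha\wedge\gamma)\vee(\neg\alpha\wedge\beta\wedge\gamma)$; $\alpha\vee(\alpha\wedge\beta)=\alpha$; $(\alpha\wedge\beta)\vee(\beta\wedge\alpha)=(\beta\wedge\alpha)\vee(\alpha\wedge\beta)$. A $C$-algebra with $T,F,U$ has constants $T$ (two-sided identity for $\wedge$), $F$ (two-sided identity for $\vee$), $U$ (fixed point of $\neg$). An ada is a $C$-algebra with $T,F,U$ and a unary operation $(\ )^\downarrow$ with $F^\downarrow=F$, $U^\downarrow=F$, $T^\downarrow=T$, $\alpha\wedge\beta^\downarrow=\alpha\wedge(\alpha\wedge\beta)^\downarrow$, $\alpha^\downarrow\vee\neg(\alpha^\downarrow)=T$, $\alpha=\alpha^\downarrow\vee\alpha$. Write $\alpha\llbracket\beta,\gamma\rrbracket=(\alpha\wedge\beta)\vee(\neg\alpha\wedge\gamma)$. A $C$-set is a pair $(S_\bot,M)$, $S_\bot$ a pointed set with base point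 $\bot$, $M$ a $C$-algebra with $T,F,U$, with a map $(\alpha,s,t)\mapsto\alpha[s,t]$, $M\times S_\bot\times S_\bot\to S_\bot$, such that: $U[s,t]=\bot$; $F[s,t]=t$; $(\neg\alpha)[s,t]=\alpha[t,s]$; $\alpha[\alpha[s,t],u]=\alpha[s,u]$; $\alpha[s,\alpha[t,u]]=\alpha[s,u]$; $(\alpha\wedge\beta)[s,t]=\alpha[\beta[s,t],t]$; $\alpha[\beta[s,t],\beta[u,v]]=\beta[\alpha[s,u],\alpha[t,v]]$; and $\alpha[s,t]=\alpha[t,t]\Rightarrow(\alpha\wedge\beta)[s,t]=(\alpha\wedge\beta)[t,t]$. A $C$-monoid is a $C$-set $(S_\bot,M)$ where $(S_\bot,\cdot)$ is a monoid with identity $1$ and zero $\bot$ (the base point), with a map $\circ:S_\bot\times M\to M$ such that for all $s,t,r,u\in S_\bot,\alpha,\beta\in M$: $\bot\circ\alpha=U$; $t\circ U=U$; $1\circ\alpha=\alpha$; $s\circ(\neg\alpha)=\neg(s\circ\alpha)$; $s\circ(\alpha\wedge\beta)=(s\circ\alpha)\wedge(s\circ\beta)$; $(s\cdot t)\circ\alpha=s\circ(t\circ\alpha)$; $\alpha[s,t]\cdot u=\alpha[s\cdot u,t\cdot u]$; $r\cdot\alpha[s,t]=(r\circ\alpha)[r\cdot s,r\cdot t]$; $\alpha[s,t]\circ\beta=\alpha\llbracket s\circ\beta,t\circ\beta\rrbracket$. -}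

module Defs where

open import Level using (Level; suc; _⊔_)
open import Relation.Binary.PropositionalEquality using (_≡_)

record CAlgebraTFU (a : Level) : Set (suc a) where
  infixr 6 _∧_
  infixr 5 _∨_
  field
    Carrier : Set a
    _∨_ _∧_ : Carrier → Carrier → Carrier
    ¬_ : Carrier → Carrier
    T F U : Carrier
    ¬¬-inv   : ∀ α → ¬ (¬ α) ≡ α
    deMorgan : ∀ α β → ¬ (α ∧ β) ≡ (¬ α) ∨ (¬ β)
    ∧-assoc  : ∀ α β γ → (α ∧ β) ∧ γ ≡ α ∧ (β ∧ γ)
    ∧-distribˡ-∨ : ∀ α β γ → α ∧ (β ∨ γ) ≡ (α ∧ β) ∨ (α ∧ γ)
    ∨-∧-distribʳ : ∀ α β γ → (α ∨ β) ∧ γ ≡ (α ∧ γ) ∨ ((¬ α) ∧ β ∧ γ)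
    absorb   : ∀ α β → α ∨ (α ∧ β) ≡ α
    comm-cond : ∀ α β → (α ∧ β) ∨ (β ∧ α) ≡ (β ∧ α) ∨ (α ∧ β)
    T-identityˡ : ∀ α → T ∧ α ≡ α
    T-identityʳ : ∀ α → α ∧ T ≡ α
    F-identityˡ : ∀ α → F ∨ α ≡ α
    F-identityʳ : ∀ α → α ∨ F ≡ α
    ¬U : ¬ U ≡ U

  _⟦_,_⟧ : Carrier → Carrier → Carrier → Carrier
  α ⟦ β , γ ⟧ = (α ∧ β) ∨ ((¬ α) ∧ γ)

record Ada (a : Level) : Set (suc a) where
  field
    calg : CAlgebraTFU a
  open CAlgebraTFU calg public
  field
    _↓ : Carrier → Carrier
    F↓ : F ↓ ≡ F
    U↓ : U ↓ ≡ F
    T↓ : T ↓ ≡ T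
    ∧-↓ : ∀ α β → α ∧ (β ↓) ≡ α ∧ ((α ∧ β) ↓)
    ↓-∨-¬ : ∀ α → (α ↓) ∨ (¬ (α ↓)) ≡ T
    ↓-∨ : ∀ α → α ≡ (α ↓) ∨ α

record CSet {a} (M : CAlgebraTFU a) (s : Level) : Set (a ⊔ suc s) where
  open CAlgebraTFU M
  field
    S : Set s
    ⊥ : S
    _[_,_] : Carrier → S → S → S
    U-sel : ∀ x y → U [ x , y ] ≡ ⊥
    F-sel : ∀ x y → F [ x , y ] ≡ y
    ¬-sel : ∀ α x y → (¬ α) [ x , y ] ≡ α [ y , x ]
    sel-l : ∀ α x y u → α [ α [ x , y ] , u ] ≡ α [ x , u ]
    sel-r : ∀ α x y u → α [ x , α [ y , u ] ] ≡ α [ x , u ]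
    ∧-sel : ∀ α β x y → (α ∧ β) [ x , y ] ≡ α [ β [ x , y ] , y ]
    sel-swap : ∀ α β x y u v →
      α [ β [ x , y ] , β [ u , v ] ] ≡ β [ α [ x , u ] , α [ y , v ] ]
    sel-cond : ∀ α β x y → α [ x , y ] ≡ α [ y , y ] →
      (α ∧ β) [ x , y ] ≡ (α ∧ β) [ y , y ]

record CMonoid {a} (M : CAlgebraTFU a) (s : Level) : Set (a ⊔ suc s) where
  field
    cset : CSet M s
  open CAlgebraTFU M
  open CSet cset public
  infixl 7 _·_
  infixr 8 _∘_
  field
    _·_ : S → S → S
    𝟙 : S
    ·-assoc : ∀ x y z → (x · y) · z ≡ x · (y · z)
    ·-identityˡ : ∀ x → 𝟙 · x ≡ x
    ·-identityʳ : ∀ x → x · 𝟙 ≡ x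
    ·-zeroˡ : ∀ x → ⊥ · x ≡ ⊥
    ·-zeroʳ : ∀ x → x · ⊥ ≡ ⊥
    _∘_ : S → Carrier → Carrier
    ⊥∘ : ∀ α → ⊥ ∘ α ≡ U
    ∘U : ∀ t → t ∘ U ≡ U
    𝟙∘ : ∀ α → 𝟙 ∘ α ≡ α
    ∘¬ : ∀ x α → x ∘ (¬ α) ≡ ¬ (x ∘ α)
    ∘∧ : ∀ x α β → x ∘ (α ∧ β) ≡ (x ∘ α) ∧ (x ∘ β)
    ·∘ : ∀ x y α → (x · y) ∘ α ≡ x ∘ (y ∘ α)
    sel-· : ∀ α x y u → (α [ x , y ]) · u ≡ α [ x · u , y · u ]
    ·-sel : ∀ r α x y → r · (α [ x , y ]) ≡ (r ∘ α) [ r · x , r · y ]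
    sel-∘ : ∀ α x y β → (α [ x , y ]) ∘ β ≡ α ⟦ x ∘ β , y ∘ β ⟧

-- Since T = ¬ F, the axioms for F and ¬ give T [ x , y ] = x, and
-- f = f · T [ 𝟙 , 𝟙 ] = (f ∘ T) [ f , f ] by left distribution of · over selection.
module Submission where

open import Defs
open import Level using (Level)
open import Relation.Binary.PropositionalEquality using (_≡_; sym; cong; module ≡-Reasoning)

module _ {a} (M : CAlgebraTFU a) where
  open CAlgebraTFU M
  open ≡-Reasoning

  ¬T≡F : ¬ T ≡ F
  ¬T≡F = begin
    ¬ T               ≡⟨ sym (F-identityʳ (¬ T)) ⟩
    ¬ T ∨ F           ≡⟨ cong (¬ T ∨_) (sym (¬¬-inv F)) ⟩
    ¬ T ∨ ¬ (¬ F)     ≡⟨ sym (deMorgan T (¬ F)) ⟩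
    ¬ (T ∧ ¬ F)       ≡⟨ cong ¬_ (T-identityˡ (¬ F)) ⟩
    ¬ (¬ F)           ≡⟨ ¬¬-inv F ⟩
    F                 ∎

  ¬F≡T : ¬ F ≡ T
  ¬F≡T = begin
    ¬ F               ≡⟨ cong ¬_ (sym ¬T≡F) ⟩
    ¬ (¬ T)           ≡⟨ ¬¬-inv T ⟩
    T                 ∎

module _ {a s} {M : CAlgebraTFU a} (C : CSet M s) where
  open CAlgebraTFU M
  open CSet C
  open ≡-Reasoning

  T-sel : ∀ x y → T [ x , y ] ≡ x
  T-sel x y = begin
    T [ x , y ]       ≡⟨ cong (_[ x , y ]) (sym (¬F≡T M)) ⟩
    (¬ F) [ x , y ]   ≡⟨ ¬-sel F x y ⟩
    F [ y , x ]       ≡⟨ F-sel y x ⟩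
    x                 ∎

module _ {a s} {M : CAlgebraTFU a} (SM : CMonoid M s) where
  open CAlgebraTFU M
  open CMonoid SM
  open ≡-Reasoning

  ∘T-sel-· : ∀ r x y → (r ∘ T) [ r · x , r · y ] ≡ r · x
  ∘T-sel-· r x y = begin
    (r ∘ T) [ r · x , r · y ]   ≡⟨ sym (·-sel r T x y) ⟩
    r · (T [ x , y ])           ≡⟨ cong (r ·_) (T-sel cset x y) ⟩
    r · x                       ∎

  ∘T-sel-diag : ∀ f → (f ∘ T) [ f , f ] ≡ f
  ∘T-sel-diag f = begin
    (f ∘ T) [ f , f ]           ≡⟨ cong (λ g → (f ∘ T) [ g , g ]) (sym (·-identityʳ f)) ⟩
    (f ∘ T) [ f · 𝟙 , f · 𝟙 ]   ≡⟨ ∘T-sel-· f 𝟙 𝟙 ⟩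
    f · 𝟙                       ≡⟨ ·-identityʳ f ⟩
    f                           ∎

corollary3p16 : ∀ {a s : Level} (A : Ada a) (SM : CMonoid (Ada.calg A) s) →
    ∀ (f : CMonoid.S SM) →
      CMonoid._[_,_] SM (CMonoid._∘_ SM f (Ada.T A)) f f ≡ f
corollary3p16 A SM = ∘T-sel-diag SM
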